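{- Suppose that $\mathcal F\subseteq\mathcal P(\omega)$ is a dense independent family and $\sigma\in\operatorname{Aut}\mathcal F$ is not the identity. Then there are pairwise distinct sets $C_n\in\mathcal F$ ($n\in\omega$) such that for all $n$, $C_{2n}\setminus C_{2n+1}\subseteq\operatorname{supp}\sigma$.
   Context: A family $\mathcal F\subseteq\mathcal P(\omega)$ is independent if for any two disjoint finite subsets $\mathcal F_1,\mathcal F_2\subseteq\mathcal F$ the set $\bigcap_{A\in\mathcal F_1}A\cap\bigcap_{B\in\mathcal F_2}(\omega\setminus B)$ is infinite. $\mathcal F$ is dense if for any two disjoint finite sets $a,b\subseteq\omega$ there are infinitely many $A\in\mathcal F$ with $a\subseteq A$ and $A\cap b=\emptyset$. $\operatorname{Aut}\mathcal F$ is the group of permutations $\sigma$ of $\omega$ with $\{\sigma[A]:A\in\mathcal F\}=\mathcal F$. For a permutation $\sigma$ of $\omega$, $\operatorname{supp}\sigma=\{n\in\omega:\sigma(n)\ne n\}$. -}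

module Defs where

open import Data.Nat using (ℕ; _≤_; _*_; suc)
open import Data.Bool using (Bool; true; false)
open import Data.List using (List)
open import Data.List.Relation.Unary.All using (All)
open import Data.List.Relation.Unary.Any using (Any)
open import Data.Product using (Σ; _×_; ∃)
open import Data.Sum using (_⊎_)
open import Relation.Nullary using (¬_)
open import Relation.Binary.PropositionalEquality using (_≡_; _≢_)
open import Function.Bundles using (_↔_; Inverse)
open import Level using (0ℓ; suc)

Subset : Set
Subset = ℕ → Bool

_∈ˢ_ : ℕ → Subset → Set
n ∈ˢ A = A n ≡ true

_≐_ : Subset → Subset → Set
A ≐ B = ∀ n → A n ≡ B n

Family : Set₁
Family = Subset → Set

_∈ᶠ_ : Subset → Family → Set
A ∈ᶠ 𝓕 = Σ Subset λ B → 𝓕 B × (A ≐ B)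

Infinite : (ℕ → Set) → Set
Infinite X = ∀ m → Σ ℕ λ n → m ≤ n × X n

DisjointSets : List Subset → List Subset → Set
DisjointSets L₁ L₂ = All (λ A → ¬ Any (λ B → A ≐ B) L₂) L₁

DisjointNats : List ℕ → List ℕ → Set
DisjointNats a b = All (λ x → ¬ Any (λ y → x ≡ y) b) a

Independent : Family → Set
Independent 𝓕 =
  (𝓕₁ 𝓕₂ : List Subset) →
  All (λ A → A ∈ᶠ 𝓕) 𝓕₁ → All (λ B → B ∈ᶠ 𝓕) 𝓕₂ →
  DisjointSets 𝓕₁ 𝓕₂ →
  Infinite (λ n → All (λ A → A n ≡ true) 𝓕₁ × All (λ B → B n ≡ false) 𝓕₂)

-- "infinitely many A ∈ 𝓕 with P A": for every finite list of sets there is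
-- such an A in 𝓕 different from all of them
InfinitelyMany : Family → (Subset → Set) → Set
InfinitelyMany 𝓕 P =
  (L : List Subset) → Σ Subset λ A → A ∈ᶠ 𝓕 × P A × All (λ B → ¬ (A ≐ B)) L

Dense : Family → Set
Dense 𝓕 =
  (a b : List ℕ) → DisjointNats a b →
  InfinitelyMany 𝓕 (λ A → All (λ x → A x ≡ true) a × All (λ y → A y ≡ false) b)

Perm : Set
Perm = ℕ ↔ ℕ

image : Perm → Subset → Subset
image σ A k = A (Inverse.from σ k)

-- σ ∈ Aut 𝓕 : {σ[A] : A ∈ 𝓕} = 𝓕
InAut : Family → Perm → Set
InAut 𝓕 σ =
  (∀ A → A ∈ᶠ 𝓕 → image σ A ∈ᶠ 𝓕) ×
  (∀ B → B ∈ᶠ 𝓕 → Σ Subset λ A → A ∈ᶠ 𝓕 × (image σ A ≐ B))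

InSupp : Perm → ℕ → Set
InSupp σ n = Inverse.to σ n ≢ n

IsIdentity : Perm → Set
IsIdentity σ = ∀ n → Inverse.to σ n ≡ n

ExcludedMiddle : Set₁
ExcludedMiddle = (P : Set) → P ⊎ ¬ P

{-# OPTIONS --safe #-}
module Submission where

-- Fix a point p moved by σ, with q = σ(p). Density yields infinitely many
-- A ∈ 𝓕 with p ∈ A and q ∉ A; choosing them one after another, each A n
-- avoids all earlier A i, σ[A i] and σ⁻¹[A i]. Then the sets σ[A n], A n are
-- pairwise distinct (σ[A n] ≠ A n since q ∈ σ[A n]), and taking
-- C (2n) = σ[A n], C (2n+1) = A n gives C (2n) ∖ C (2n+1) ⊆ supp σ, because
-- σ[A] and A agree at every fixed point of σ.

open import Defs
open import Data.Nat using (ℕ; _*_; suc; zero; _<_)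
open import Data.Nat.Properties using (_≟_; <-cmp; *-suc; m<1+n⇒m<n∨m≡n)
open import Data.Bool using (true; false)
open import Data.Product using (Σ; _×_; _,_; proj₁; proj₂)
open import Data.Sum using (inj₁; inj₂)
open import Data.Empty using (⊥-elim)
open import Data.List using (List; []; _∷_; _++_)
open import Data.List.Relation.Unary.All using (All; []; _∷_; head; tail)
open import Data.List.Relation.Unary.All.Properties using (++⁻ˡ; ++⁻ʳ)
open import Data.List.Relation.Unary.Any using (here)
open import Function using (_∘_)
open import Function.Bundles using (Inverse)
open import Relation.Nullary using (¬_)
open import Relation.Nullary.Decidable using (decidable-stable)
open import Relation.Binary.Core using (Rel)
open import Relation.Binary.Definitions using (Symmetric; tri<; tri≈; tri>)
open import Relation.Binary.PropositionalEquality
  using (_≡_; _≢_; refl; sym; trans; cong; subst; subst₂)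

Separated : ∀ {a ℓ} {X : Set a} → Rel X ℓ → (ℕ → X) → Set ℓ
Separated _≈_ f = ∀ i j → i ≢ j → ¬ (f i ≈ f j)

separated-if-fresh : ∀ {a ℓ} {X : Set a} {_≈_ : Rel X ℓ} {f : ℕ → X} →
  Symmetric _≈_ → (∀ {i n} → i < n → ¬ (f n ≈ f i)) → Separated _≈_ f
separated-if-fresh ≈-sym fresh i j i≢j fi≈fj with <-cmp i j
... | tri< i<j _ _ = fresh i<j (≈-sym fi≈fj)
... | tri≈ _ i≡j _ = i≢j i≡j
... | tri> _ _ j<i = fresh j<i fi≈fj

data EvenOrOdd : ℕ → Set where
  even : ∀ n → EvenOrOdd (2 * n)
  odd  : ∀ n → EvenOrOdd (suc (2 * n))

evenOrOdd : ∀ m → EvenOrOdd m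
evenOrOdd zero = even 0
evenOrOdd (suc m) with evenOrOdd m
... | even n = odd n
... | odd n  = subst EvenOrOdd (*-suc 2 n) (even (suc n))

module _ {a} {X : Set a} where

  interleave : (ℕ → X) → (ℕ → X) → ℕ → X
  interleave f g zero    = f zero
  interleave f g (suc m) = interleave g (f ∘ suc) m

  interleave-even : ∀ f g n → interleave f g (2 * n) ≡ f n
  interleave-even f g zero = refl
  interleave-even f g (suc n) =
    subst (λ m → interleave f g m ≡ f (suc n)) (sym (*-suc 2 n))
      (interleave-even (f ∘ suc) (g ∘ suc) n)

  interleave-odd : ∀ f g n → interleave f g (suc (2 * n)) ≡ g n
  interleave-odd f g = interleave-even g (f ∘ suc)

  interleave-all : ∀ {ℓ} (Q : X → Set ℓ) {f g} →
    (∀ n → Q (f n)) → (∀ n → Q (g n)) → ∀ m → Q (interleave f g m)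
  interleave-all Q Qf Qg zero    = Qf zero
  interleave-all Q Qf Qg (suc m) = interleave-all Q Qg (Qf ∘ suc) m

  interleave-separated : ∀ {ℓ} {_≈_ : Rel X ℓ} {f g} → Symmetric _≈_ →
    Separated _≈_ f → Separated _≈_ g → (∀ i j → ¬ (f i ≈ g j)) →
    Separated _≈_ (interleave f g)
  interleave-separated {_≈_ = _≈_} {f} {g} ≈-sym f-sep g-sep f≉g i j i≢j
    with evenOrOdd i | evenOrOdd j
  ... | even n | even m =
    f-sep n m (i≢j ∘ cong (2 *_)) ∘ subst₂ _≈_ (interleave-even f g n) (interleave-even f g m)
  ... | even n | odd m =
    f≉g n m ∘ subst₂ _≈_ (interleave-even f g n) (interleave-odd f g m)
  ... | odd n | even m =
    f≉g m n ∘ ≈-sym ∘ subst₂ _≈_ (interleave-odd f g n) (interleave-even f g m)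
  ... | odd n | odd m =
    g-sep n m (i≢j ∘ cong (suc ∘ (2 *_))) ∘ subst₂ _≈_ (interleave-odd f g n) (interleave-odd f g m)

≐-sym : Symmetric _≐_
≐-sym A≐B k = sym (A≐B k)

module AvoidingSequence {𝓕 : Family} {P : Subset → Set}
  (many : InfinitelyMany 𝓕 P) (forbidden : Subset → List Subset) where

  mutual
    A : ℕ → Subset
    A n = proj₁ (many (history n))

    history : ℕ → List Subset
    history zero    = []
    history (suc n) = forbidden (A n) ++ history n

  A-∈ᶠ : ∀ n → A n ∈ᶠ 𝓕
  A-∈ᶠ n = proj₁ (proj₂ (many (history n)))

  A-satisfies : ∀ n → P (A n)
  A-satisfies n = proj₁ (proj₂ (proj₂ (many (history n))))

  history-⊇ : ∀ {q} {Q : Subset → Set q} {i n} → i < n →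
    All Q (history n) → All Q (forbidden (A i))
  history-⊇ {n = suc n} i<1+n Qs with m<1+n⇒m<n∨m≡n i<1+n
  ... | inj₁ i<n  = history-⊇ i<n (++⁻ʳ (forbidden (A n)) Qs)
  ... | inj₂ refl = ++⁻ˡ (forbidden (A n)) Qs

  A-avoids-earlier : ∀ {i n} → i < n → All (λ B → ¬ (A n ≐ B)) (forbidden (A i))
  A-avoids-earlier {n = n} i<n = history-⊇ i<n (proj₂ (proj₂ (proj₂ (many (history n)))))

module _ (σ : Perm) where
  open Inverse σ using (to; strictlyInverseʳ)

  preimage : Subset → Subset
  preimage B k = B (to k)

  image-to : ∀ A k → image σ A (to k) ≡ A k
  image-to A k = cong A (strictlyInverseʳ k)

  image-injective : ∀ {A B} → image σ A ≐ image σ B → A ≐ B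
  image-injective {A} {B} σA≐σB k =
    subst₂ _≡_ (image-to A k) (image-to B k) (σA≐σB (to k))

  image≐⇒≐preimage : ∀ {A B} → image σ A ≐ B → A ≐ preimage B
  image≐⇒≐preimage {A} σA≐B k = trans (sym (image-to A k)) (σA≐B (to k))

  image-fixed : ∀ A {k} → to k ≡ k → image σ A k ≡ A k
  image-fixed A {k} σk≡k = trans (cong (image σ A) (sym σk≡k)) (image-to A k)

  image≉self : ∀ A {k} → A k ≡ true → A (to k) ≡ false → ¬ (image σ A ≐ A)
  image≉self A {k} k∈A σk∉A σA≐A
    with trans (sym k∈A) (trans (sym (image-to A k)) (trans (σA≐A (to k)) σk∉A))
  ... | ()

  image∖⊆supp : ∀ A k → image σ A k ≡ true → A k ≡ false → InSupp σ k
  image∖⊆supp A k k∈σA k∉A σk≡k with trans (sym k∈σA) (trans (image-fixed A σk≡k) k∉A)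
  ... | ()

  moved-point : ExcludedMiddle → ¬ IsIdentity σ → Σ ℕ (InSupp σ)
  moved-point em ¬id with em (Σ ℕ (InSupp σ))
  ... | inj₁ moved = moved
  ... | inj₂ none  =
    ⊥-elim (¬id λ n → decidable-stable (to n ≟ n) (λ n-moved → none (n , n-moved)))

module SeparatingSets {𝓕 : Family} (dense : Dense 𝓕) (σ : Perm) {p : ℕ} (p-moved : InSupp σ p) where
  open Inverse σ using (to)

  p∉[σp] : DisjointNats (p ∷ []) (to p ∷ [])
  p∉[σp] = (λ { (here p≡σp) → p-moved (sym p≡σp) }) ∷ []

  open AvoidingSequence (dense (p ∷ []) (to p ∷ []) p∉[σp])
                        (λ B → B ∷ image σ B ∷ preimage σ B ∷ [])

  A-separated : Separated _≐_ A
  A-separated = separated-if-fresh {_≈_ = _≐_} ≐-sym (head ∘ A-avoids-earlier)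

  image-A-separated : Separated _≐_ (image σ ∘ A)
  image-A-separated i j i≢j = A-separated i j i≢j ∘ image-injective σ

  image-A≉A : ∀ i j → ¬ (image σ (A i) ≐ A j)
  image-A≉A i j σAi≐Aj with <-cmp i j
  ... | tri< i<j _ _ = head (tail (A-avoids-earlier i<j)) (≐-sym σAi≐Aj)
  ... | tri> _ _ j<i = head (tail (tail (A-avoids-earlier j<i))) (image≐⇒≐preimage σ σAi≐Aj)
  ... | tri≈ _ refl _ =
    image≉self σ (A i) (head (proj₁ (A-satisfies i))) (head (proj₂ (A-satisfies i))) σAi≐Aj

  C : ℕ → Subset
  C = interleave (image σ ∘ A) A

  C-∈ᶠ : InAut 𝓕 σ → ∀ n → C n ∈ᶠ 𝓕
  C-∈ᶠ (image-∈ᶠ , _) = interleave-all (_∈ᶠ 𝓕) (λ n → image-∈ᶠ (A n) (A-∈ᶠ n)) A-∈ᶠ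

  C-separated : Separated _≐_ C
  C-separated = interleave-separated {_≈_ = _≐_} ≐-sym image-A-separated A-separated image-A≉A

  C-even∖odd⊆supp : ∀ n k → C (2 * n) k ≡ true → C (suc (2 * n)) k ≡ false → InSupp σ k
  C-even∖odd⊆supp n k k∈C₂ₙ k∉C₂ₙ₊₁ =
    image∖⊆supp σ (A n) k
      (subst (λ X → X k ≡ true) (interleave-even (image σ ∘ A) A n) k∈C₂ₙ)
      (subst (λ X → X k ≡ false) (interleave-odd (image σ ∘ A) A n) k∉C₂ₙ₊₁)

mainTheorem11 : ExcludedMiddle → (𝓕 : Family) → Dense 𝓕 → Independent 𝓕 →
    (σ : Perm) → InAut 𝓕 σ → ¬ IsIdentity σ →
    Σ (ℕ → Subset) λ C →
      (∀ n → C n ∈ᶠ 𝓕) ×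
      (∀ i j → i ≢ j → ¬ (C i ≐ C j)) ×
      (∀ n k → C (2 * n) k ≡ true → C (suc (2 * n)) k ≡ false → InSupp σ k)
mainTheorem11 em 𝓕 dense _ σ aut ¬id =
  let (p , p-moved) = moved-point σ em ¬id
      open SeparatingSets dense σ p-moved
  in C , C-∈ᶠ aut , C-separated , C-even∖odd⊆supp
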